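{- Let $G$ and $H$ be graphs, each with no universal vertex. Then $\mathcal{R}(G\vee H)$ is isomorphic to the graph $X$ defined as follows. The vertex set of $X$ is the disjoint union of $\mathcal{M}(G)$, $\mathcal{M}(H)$ and $V(G)\times V(H)$. The edges of $X$ are: the edges of $\mathcal{R}(G)$ on $\mathcal{M}(G)$; the edges of $\mathcal{R}(H)$ on $\mathcal{M}(H)$; the edges of the Cartesian product $G\,\square\,H$ on $V(G)\times V(H)$; and, for $M\in\mathcal{M}(G)\cup\mathcal{M}(H)$ and $(u,v)\in V(G)\times V(H)$, an edge between $M$ and $(u,v)$ if and only if $M\cap\{u,v\}\neq\emptyset$. There are no other edges (in particular no edges between $\mathcal{M}(G)$ and $\mathcal{M}(H)$).
   Context: All graphs are finite, simple and undirected; $N(v)$ denotes the open neighbourhood of $v$. A set $S\subseteq V(G)$ is a dominating set if every vertex of $G$ is in $S$ or adjacent to a vertex of $S$; it is a minimal dominating set if no proper subset of $S$ is a dominating set. $\mathcal{M}(G)$ denotes the set of minimal dominating sets of $G$. The reconfiguration graph $\mathcal{R}(G)$ has vertex set $\mathcal{M}(G)$, and two minimal dominating sets $M_1,M_2$ are adjacent iff there is a vertex $v$ with either ($M_2\setminus M_1=\{v\}$ and $M_1\setminus M_2\subseteq N(v)$) or ($M_1\setminus M_2=\{v\}$ and $M_2\setminus M_1\subseteq N(v)$). A universal vertex is a vertex adjacent to all other vertices. The join $G\vee H$ is the disjoint union of $G$ and $H$ together with all edges between $V(G)$ and $V(H)$. The Cartesian product $G\,\square\,H$ has vertex set $V(G)\times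 V(H)$ with $(u,v)\sim(u',v')$ iff either $u=u'$ and $v\sim v'$ in $H$, or $v=v'$ and $u\sim u'$ in $G$. -}

module Defs where

import Data.Nat
open import Data.Nat using (ℕ; _≤_)
open import Data.Fin using (Fin; splitAt)
open import Data.Fin.Subset using (Subset; _∈_; _∉_; _⊆_)
open import Data.Sum using (_⊎_; inj₁; inj₂)
open import Data.Product using (Σ; ∃; _×_; _,_)
open import Data.Unit using (⊤; tt)
open import Data.Empty using (⊥)
open import Relation.Nullary using (¬_; Dec; yes; no)
open import Relation.Binary.PropositionalEquality using (_≡_; _≢_)
open import Function.Bundles using (_⤖_; _⇔_; Bijection)

record Graph : Set₁ where
  field
    n      : ℕ
    Adj    : Fin n → Fin n → Set
    adj?   : ∀ u v → Dec (Adj u v)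
    sym    : ∀ {u v} → Adj u v → Adj v u
    irrefl : ∀ {u} → ¬ Adj u u
open Graph public

Universal : (G : Graph) → Fin (n G) → Set
Universal G u = ∀ v → v ≢ u → Adj G u v

NoUniversal : Graph → Set
NoUniversal G = ∀ u → ¬ Universal G u

Dominating : (G : Graph) → Subset (n G) → Set
Dominating G S = ∀ v → v ∈ S ⊎ ∃ λ u → u ∈ S × Adj G u v

IsMinDom : (G : Graph) → Subset (n G) → Set
IsMinDom G S = Dominating G S × (∀ T → T ⊆ S → Dominating G T → T ≡ S)

-- M(G): minimal dominating sets (the proof of minimality is irrelevant,
-- so two elements are equal iff their underlying sets are equal).
record MinDom (G : Graph) : Set where
  constructor mkMD
  field
    set      : Subset (n G)
    .isMinDom : IsMinDom G set
open MinDom public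

Step : (G : Graph) → Subset (n G) → Subset (n G) → Set
Step G M₁ M₂ = ∃ λ v →
  (∀ w → (w ∈ M₂ × w ∉ M₁) ⇔ (w ≡ v)) ×
  (∀ w → w ∈ M₁ → w ∉ M₂ → Adj G v w)

RAdj : (G : Graph) → MinDom G → MinDom G → Set
RAdj G M₁ M₂ = Step G (set M₁) (set M₂) ⊎ Step G (set M₂) (set M₁)

-- The join G ∨ H on vertex set Fin (n G + n H) (first n G vertices are G's).
JAdj' : (G H : Graph) → Fin (n G) ⊎ Fin (n H) → Fin (n G) ⊎ Fin (n H) → Set
JAdj' G H (inj₁ a) (inj₁ b) = Adj G a b
JAdj' G H (inj₂ a) (inj₂ b) = Adj H a b
JAdj' G H (inj₁ a) (inj₂ b) = ⊤
JAdj' G H (inj₂ a) (inj₁ b) = ⊤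

JAdj'? : (G H : Graph) → ∀ x y → Dec (JAdj' G H x y)
JAdj'? G H (inj₁ a) (inj₁ b) = adj? G a b
JAdj'? G H (inj₂ a) (inj₂ b) = adj? H a b
JAdj'? G H (inj₁ a) (inj₂ b) = yes tt
JAdj'? G H (inj₂ a) (inj₁ b) = yes tt

JAdj'-sym : (G H : Graph) → ∀ x y → JAdj' G H x y → JAdj' G H y x
JAdj'-sym G H (inj₁ a) (inj₁ b) p = sym G p
JAdj'-sym G H (inj₂ a) (inj₂ b) p = sym H p
JAdj'-sym G H (inj₁ a) (inj₂ b) p = tt
JAdj'-sym G H (inj₂ a) (inj₁ b) p = tt

JAdj'-irr : (G H : Graph) → ∀ x → ¬ JAdj' G H x x
JAdj'-irr G H (inj₁ a) = irrefl G
JAdj'-irr G H (inj₂ a) = irrefl H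

_∨ᴳ_ : Graph → Graph → Graph
G ∨ᴳ H = record
  { n      = n G Data.Nat.+ n H
  ; Adj    = λ i j → JAdj' G H (splitAt (n G) i) (splitAt (n G) j)
  ; adj?   = λ i j → JAdj'? G H (splitAt (n G) i) (splitAt (n G) j)
  ; sym    = λ {i} {j} → JAdj'-sym G H (splitAt (n G) i) (splitAt (n G) j)
  ; irrefl = λ {i} → JAdj'-irr G H (splitAt (n G) i)
  }

XVert : Graph → Graph → Set
XVert G H = MinDom G ⊎ (MinDom H ⊎ (Fin (n G) × Fin (n H)))

XAdj : (G H : Graph) → XVert G H → XVert G H → Set
XAdj G H (inj₁ M) (inj₁ M') = RAdj G M M'
XAdj G H (inj₂ (inj₁ M)) (inj₂ (inj₁ M')) = RAdj H M M'
XAdj G H (inj₂ (inj₂ (u , v))) (inj₂ (inj₂ (u' , v'))) =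
  (u ≡ u' × Adj H v v') ⊎ (v ≡ v' × Adj G u u')
-- M ∩ {u,v} ≠ ∅; for M ⊆ V(G) this means u ∈ M, for M ⊆ V(H) it means v ∈ M.
XAdj G H (inj₁ M) (inj₂ (inj₂ (u , v))) = u ∈ set M
XAdj G H (inj₂ (inj₂ (u , v))) (inj₁ M) = u ∈ set M
XAdj G H (inj₂ (inj₁ M)) (inj₂ (inj₂ (u , v))) = v ∈ set M
XAdj G H (inj₂ (inj₂ (u , v))) (inj₂ (inj₁ M)) = v ∈ set M
XAdj G H (inj₁ M) (inj₂ (inj₁ M')) = ⊥
XAdj G H (inj₂ (inj₁ M)) (inj₁ M') = ⊥

Isomorphic : (V W : Set) → (V → V → Set) → (W → W → Set) → Set
Isomorphic V W A B =
  Σ (V ⤖ W) λ f → ∀ x y → A x y ⇔ B (Bijection.to f x) (Bijection.to f y)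

module Submission where

-- A minimal dominating set S of G ∨ H either lies inside one side, where it is exactly a minimal
-- dominating set of that graph, or meets both sides in vertices u and v; then {u, v} already
-- dominates, so S = {u, v}, and {u, v} is minimal because neither u nor v is universal in its own
-- graph. Reading off the reconfiguration steps between sets of these three shapes gives the edges
-- of X; the absence of universal vertices rules out every step that X does not have.

open import Defs hiding (sym)
open import Data.Nat using (ℕ; _≤_; _+_)
open import Data.Fin using (Fin; splitAt; fromℕ<; _↑ˡ_; _↑ʳ_)
open import Data.Fin.Properties
  using (splitAt-↑ˡ; splitAt-↑ʳ; join-splitAt; ↑ˡ-injective; ↑ʳ-injective; any?; all?)
  renaming (_≟_ to _≟ᶠ_)
open import Data.Fin.Subset using (Subset; _∈_; _∉_; _⊆_; ⁅_⁆; Nonempty; Empty) renaming (⊥ to ∅)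
open import Data.Fin.Subset.Properties using (_∈?_; nonempty?; x∈⁅x⁆; x∈⁅y⁆⇒x≡y; Empty-unique; ∉⊥; ⊆-antisym)
open import Data.Vec using (Vec; lookup; tabulate; _++_)
open import Data.Vec.Properties
  using (lookup-++ˡ; lookup-++ʳ; []=⇒lookup; lookup⇒[]=; lookup∘tabulate; tabulate∘lookup; tabulate-cong; ≡-dec)
open import Data.Bool using () renaming (_≟_ to _≟ᵇ_)
open import Data.Sum using (_⊎_; inj₁; inj₂; [_,_]; swap) renaming (map to ⊎-map)
open import Data.Product using (∃; _×_; _,_; proj₁; proj₂)
open import Data.Unit using (tt)
open import Data.Empty using (⊥; ⊥-elim; ⊥-elim-irr)
open import Function using (id; _∘_)
open import Relation.Nullary using (¬_; Dec; yes; no)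
open import Relation.Nullary.Decidable using (recompute; _⊎-dec_; _×-dec_)
open import Relation.Binary.PropositionalEquality using (_≡_; _≢_; refl; sym; trans; cong; cong₂; subst; subst₂)
open import Function.Bundles using (_⤖_; _⇔_; mk⇔; mk⤖; Equivalence)
open Equivalence using (to; from)

lookup-ext : ∀ {A : Set} {n} {xs ys : Vec A n} → (∀ i → lookup xs i ≡ lookup ys i) → xs ≡ ys
lookup-ext {xs = xs} {ys} eq = trans (sym (tabulate∘lookup xs)) (trans (tabulate-cong eq) (tabulate∘lookup ys))

∈-resp-lookup : ∀ {n m} {S : Subset n} {T : Subset m} {i j} → lookup S i ≡ lookup T j → i ∈ S → j ∈ T
∈-resp-lookup {T = T} {i} {j} eq i∈S = lookup⇒[]= j T (trans (sym eq) ([]=⇒lookup i∈S))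

⇔-⊎-swap : ∀ {P Q R : Set} → P ⇔ (Q ⊎ R) → P ⇔ (R ⊎ Q)
⇔-⊎-swap e = mk⇔ (swap ∘ to e) (from e ∘ swap)

StepVia : (G : Graph) → Subset (n G) → Subset (n G) → Fin (n G) → Set
StepVia G M₁ M₂ v = (∀ w → (w ∈ M₂ × w ∉ M₁) ⇔ (w ≡ v)) × (∀ w → w ∈ M₁ → w ∉ M₂ → Adj G v w)

dominating? : (G : Graph) (S : Subset (n G)) → Dec (Dominating G S)
dominating? G S = all? (λ v → (v ∈? S) ⊎-dec any? (λ u → (u ∈? S) ×-dec adj? G u v))

-- The proof of minimality inside a MinDom is irrelevant; being decidable, it can be recomputed.
minDom-dominating : ∀ {G} (M : MinDom G) → Dominating G (set M)
minDom-dominating {G} (mkMD S p) = recompute (dominating? G S) (proj₁ p)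

minDom-minimal : ∀ {G} (M : MinDom G) → ∀ T → T ⊆ set M → Dominating G T → T ≡ set M
minDom-minimal (mkMD S p) T T⊆S dom = recompute (≡-dec _≟ᵇ_ T S) (proj₂ p T T⊆S dom)

minDom-≡ : ∀ G {S T : Subset (n G)} .{p : IsMinDom G S} .{q : IsMinDom G T} →
           S ≡ T → _≡_ {A = MinDom G} (mkMD S p) (mkMD T q)
minDom-≡ _ refl = refl

dominating⇒nonempty : ∀ G {S} → Fin (n G) → Dominating G S → Nonempty S
dominating⇒nonempty _ v dom with dom v
... | inj₁ v∈S = v , v∈S
... | inj₂ (u , u∈S , _) = u , u∈S

dominating⇒universal : ∀ G {S c} → Dominating G S → (∀ x → x ∈ S → x ≡ c) → Universal G c
dominating⇒universal G dom S⊆c v v≢c with dom v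
... | inj₁ v∈S = ⊥-elim (v≢c (S⊆c v v∈S))
... | inj₂ (x , x∈S , x~v) = subst (λ z → Adj G z v) (S⊆c x x∈S) x~v

module JoinReconfiguration (G H : Graph) (1≤nG : 1 ≤ n G) (1≤nH : 1 ≤ n H)
                           (noUniversalG : NoUniversal G) (noUniversalH : NoUniversal H) where
  m k N : ℕ
  m = n G
  k = n H
  N = m + k

  J : Graph
  J = G ∨ᴳ H

  -- The join seen from one of its sides Γ, the other side being Δ. It is instantiated once with
  -- Γ = G and once with Γ = H, so that every argument below is written only once.
  record JoinView : Set₁ where
    field
      Γ Δ : Graph
      ι : Fin (n Γ) → Fin N
      κ : Fin (n Δ) → Fin N
      _⊕_ : Subset (n Γ) → Subset (n Δ) → Subset N
      lookup-⊕-ι : ∀ A B x → lookup (A ⊕ B) (ι x) ≡ lookup A x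
      lookup-⊕-κ : ∀ A B y → lookup (A ⊕ B) (κ y) ≡ lookup B y
      ι-injective : ∀ {x y} → ι x ≡ ι y → x ≡ y
      κ-injective : ∀ {x y} → κ x ≡ κ y → x ≡ y
      ι≢κ : ∀ {x y} → ι x ≢ κ y
      ι-or-κ : ∀ i → (∃ λ x → ι x ≡ i) ⊎ (∃ λ y → κ y ≡ i)
      Adj-ι : ∀ {x y} → Adj Γ x y → Adj J (ι x) (ι y)
      Adj-ι⁻ : ∀ {x y} → Adj J (ι x) (ι y) → Adj Γ x y
      Adj-κ⁻ : ∀ {x y} → Adj J (κ x) (κ y) → Adj Δ x y
      Adj-ικ : ∀ {x y} → Adj J (ι x) (κ y)
      Adj-κι : ∀ {x y} → Adj J (κ y) (ι x)
      γ₀ : Fin (n Γ)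
      noUniversalΓ : NoUniversal Γ
      noUniversalΔ : NoUniversal Δ

  ↑ˡ≢↑ʳ : ∀ {x : Fin m} {y : Fin k} → x ↑ˡ k ≢ m ↑ʳ y
  ↑ˡ≢↑ʳ {x} {y} eq with trans (sym (splitAt-↑ˡ m x k)) (trans (cong (splitAt m) eq) (splitAt-↑ʳ m k y))
  ... | ()

  ↑ˡ-or-↑ʳ : ∀ i → (∃ λ x → x ↑ˡ k ≡ i) ⊎ (∃ λ y → m ↑ʳ y ≡ i)
  ↑ˡ-or-↑ʳ i with splitAt m i | join-splitAt m k i
  ... | inj₁ x | eq = inj₁ (x , eq)
  ... | inj₂ y | eq = inj₂ (y , eq)

  Adj-↑ˡ↑ˡ : ∀ {x y} → Adj J (x ↑ˡ k) (y ↑ˡ k) ≡ Adj G x y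
  Adj-↑ˡ↑ˡ {x} {y} = cong₂ (JAdj' G H) (splitAt-↑ˡ m x k) (splitAt-↑ˡ m y k)

  Adj-↑ʳ↑ʳ : ∀ {x y} → Adj J (m ↑ʳ x) (m ↑ʳ y) ≡ Adj H x y
  Adj-↑ʳ↑ʳ {x} {y} = cong₂ (JAdj' G H) (splitAt-↑ʳ m k x) (splitAt-↑ʳ m k y)

  Adj-↑ˡ↑ʳ : ∀ {x y} → Adj J (x ↑ˡ k) (m ↑ʳ y)
  Adj-↑ˡ↑ʳ {x} {y} = subst id (cong₂ (JAdj' G H) (sym (splitAt-↑ˡ m x k)) (sym (splitAt-↑ʳ m k y))) tt

  Adj-↑ʳ↑ˡ : ∀ {x y} → Adj J (m ↑ʳ y) (x ↑ˡ k)
  Adj-↑ʳ↑ˡ {x} {y} = subst id (cong₂ (JAdj' G H) (sym (splitAt-↑ʳ m k y)) (sym (splitAt-↑ˡ m x k))) tt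

  viewG : JoinView
  viewG = record
    { Γ = G ; Δ = H ; ι = _↑ˡ k ; κ = m ↑ʳ_ ; _⊕_ = _++_
    ; lookup-⊕-ι = lookup-++ˡ
    ; lookup-⊕-κ = lookup-++ʳ
    ; ι-injective = ↑ˡ-injective k _ _
    ; κ-injective = ↑ʳ-injective m _ _
    ; ι≢κ = ↑ˡ≢↑ʳ
    ; ι-or-κ = ↑ˡ-or-↑ʳ
    ; Adj-ι = subst id (sym Adj-↑ˡ↑ˡ)
    ; Adj-ι⁻ = subst id Adj-↑ˡ↑ˡ
    ; Adj-κ⁻ = subst id Adj-↑ʳ↑ʳ
    ; Adj-ικ = Adj-↑ˡ↑ʳ
    ; Adj-κι = Adj-↑ʳ↑ˡ
    ; γ₀ = fromℕ< 1≤nG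
    ; noUniversalΓ = noUniversalG
    ; noUniversalΔ = noUniversalH
    }

  viewH : JoinView
  viewH = record
    { Γ = H ; Δ = G ; ι = m ↑ʳ_ ; κ = _↑ˡ k ; _⊕_ = λ A B → B ++ A
    ; lookup-⊕-ι = λ A B → lookup-++ʳ B A
    ; lookup-⊕-κ = λ A B → lookup-++ˡ B A
    ; ι-injective = ↑ʳ-injective m _ _
    ; κ-injective = ↑ˡ-injective k _ _
    ; ι≢κ = ↑ˡ≢↑ʳ ∘ sym
    ; ι-or-κ = swap ∘ ↑ˡ-or-↑ʳ
    ; Adj-ι = subst id (sym Adj-↑ʳ↑ʳ)
    ; Adj-ι⁻ = subst id Adj-↑ʳ↑ʳ
    ; Adj-κ⁻ = subst id Adj-↑ˡ↑ˡ
    ; Adj-ικ = Adj-↑ʳ↑ˡ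
    ; Adj-κι = Adj-↑ˡ↑ʳ
    ; γ₀ = fromℕ< 1≤nH
    ; noUniversalΓ = noUniversalH
    ; noUniversalΔ = noUniversalG
    }

  module JoinViewProperties (σ : JoinView) where
    open JoinView σ

    ∈⇒ι∈⊕ : ∀ {A B x} → x ∈ A → ι x ∈ A ⊕ B
    ∈⇒ι∈⊕ {A} {B} {x} = ∈-resp-lookup (sym (lookup-⊕-ι A B x))

    ι∈⊕⇒∈ : ∀ {A B x} → ι x ∈ A ⊕ B → x ∈ A
    ι∈⊕⇒∈ {A} {B} {x} = ∈-resp-lookup (lookup-⊕-ι A B x)

    ∈⇒κ∈⊕ : ∀ {A B y} → y ∈ B → κ y ∈ A ⊕ B
    ∈⇒κ∈⊕ {A} {B} {y} = ∈-resp-lookup (sym (lookup-⊕-κ A B y))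

    κ∈⊕⇒∈ : ∀ {A B y} → κ y ∈ A ⊕ B → y ∈ B
    κ∈⊕⇒∈ {A} {B} {y} = ∈-resp-lookup (lookup-⊕-κ A B y)

    κ∉⊕∅ : ∀ {A y} → κ y ∉ A ⊕ ∅
    κ∉⊕∅ = ∉⊥ ∘ κ∈⊕⇒∈

    ⊕-mono : ∀ {A A' B B'} → A ⊆ A' → B ⊆ B' → A ⊕ B ⊆ A' ⊕ B'
    ⊕-mono A⊆A' B⊆B' {i} i∈ with ι-or-κ i
    ... | inj₁ (x , refl) = ∈⇒ι∈⊕ (A⊆A' (ι∈⊕⇒∈ i∈))
    ... | inj₂ (y , refl) = ∈⇒κ∈⊕ (B⊆B' (κ∈⊕⇒∈ i∈))

    partΓ : Subset N → Subset (n Γ)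
    partΓ S = tabulate (λ x → lookup S (ι x))

    partΔ : Subset N → Subset (n Δ)
    partΔ S = tabulate (λ y → lookup S (κ y))

    ∈partΓ⇒ι∈ : ∀ {S x} → x ∈ partΓ S → ι x ∈ S
    ∈partΓ⇒ι∈ {S} {x} = ∈-resp-lookup (lookup∘tabulate (λ x → lookup S (ι x)) x)

    ι∈⇒∈partΓ : ∀ {S x} → ι x ∈ S → x ∈ partΓ S
    ι∈⇒∈partΓ {S} {x} = ∈-resp-lookup (sym (lookup∘tabulate (λ x → lookup S (ι x)) x))

    ∈partΔ⇒κ∈ : ∀ {S y} → y ∈ partΔ S → κ y ∈ S
    ∈partΔ⇒κ∈ {S} {y} = ∈-resp-lookup (lookup∘tabulate (λ y → lookup S (κ y)) y)

    κ∈⇒∈partΔ : ∀ {S y} → κ y ∈ S → y ∈ partΔ S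
    κ∈⇒∈partΔ {S} {y} = ∈-resp-lookup (sym (lookup∘tabulate (λ y → lookup S (κ y)) y))

    partΓ-⊕ : ∀ A B → partΓ (A ⊕ B) ≡ A
    partΓ-⊕ A B = lookup-ext λ x → trans (lookup∘tabulate _ x) (lookup-⊕-ι A B x)

    partΓ-nonempty : ∀ {A B a} → a ∈ A → Nonempty (partΓ (A ⊕ B))
    partΓ-nonempty {a = a} a∈A = a , ι∈⇒∈partΓ (∈⇒ι∈⊕ a∈A)

    partΔ-nonempty : ∀ {A B b} → b ∈ B → Nonempty (partΔ (A ⊕ B))
    partΔ-nonempty {b = b} b∈B = b , κ∈⇒∈partΔ (∈⇒κ∈⊕ b∈B)

    ≡-⊕-parts : ∀ S → S ≡ partΓ S ⊕ partΔ S
    ≡-⊕-parts S = lookup-ext same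
      where
      same : ∀ i → lookup S i ≡ lookup (partΓ S ⊕ partΔ S) i
      same i with ι-or-κ i
      ... | inj₁ (x , refl) = sym (trans (lookup-⊕-ι _ _ x) (lookup∘tabulate _ x))
      ... | inj₂ (y , refl) = sym (trans (lookup-⊕-κ _ _ y) (lookup∘tabulate _ y))

    ≡partΓ⊕∅ : ∀ {S} → Empty (partΔ S) → S ≡ partΓ S ⊕ ∅
    ≡partΓ⊕∅ {S} partΔ-empty = trans (≡-⊕-parts S) (cong (partΓ S ⊕_) (Empty-unique partΔ-empty))

    ⊆⊕∅⇒≡partΓ⊕∅ : ∀ {T A} → T ⊆ A ⊕ ∅ → T ≡ partΓ T ⊕ ∅
    ⊆⊕∅⇒≡partΓ⊕∅ T⊆ = ≡partΓ⊕∅ λ (y , y∈) → κ∉⊕∅ (T⊆ (∈partΔ⇒κ∈ y∈))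

    ⊕-dominating : ∀ {A B a b} → a ∈ A → b ∈ B → Dominating J (A ⊕ B)
    ⊕-dominating {b = b} a∈A b∈B i with ι-or-κ i
    ... | inj₁ (x , refl) = inj₂ (κ b , ∈⇒κ∈⊕ b∈B , Adj-κι)
    ... | inj₂ (y , refl) = inj₂ (ι _ , ∈⇒ι∈⊕ a∈A , Adj-ικ)

    ⊕∅-dominating : ∀ {A} → Dominating Γ A → Dominating J (A ⊕ ∅)
    ⊕∅-dominating dom i with ι-or-κ i
    ... | inj₂ (y , refl) = inj₂ (ι _ , ∈⇒ι∈⊕ (proj₂ (dominating⇒nonempty Γ γ₀ dom)) , Adj-ικ)
    ... | inj₁ (x , refl) with dom x
    ...   | inj₁ x∈A = inj₁ (∈⇒ι∈⊕ x∈A)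
    ...   | inj₂ (u , u∈A , u~x) = inj₂ (ι u , ∈⇒ι∈⊕ u∈A , Adj-ι u~x)

    ⊕∅-dominating⁻ : ∀ {A} → Dominating J (A ⊕ ∅) → Dominating Γ A
    ⊕∅-dominating⁻ dom x with dom (ι x)
    ... | inj₁ ιx∈ = inj₁ (ι∈⊕⇒∈ ιx∈)
    ... | inj₂ (i , i∈ , i~ιx) with ι-or-κ i
    ...   | inj₁ (u , refl) = inj₂ (u , ι∈⊕⇒∈ i∈ , Adj-ι⁻ i~ιx)
    ...   | inj₂ (y , refl) = ⊥-elim (κ∉⊕∅ i∈)

    ⊕∅-minDom : ∀ {A} → IsMinDom Γ A → IsMinDom J (A ⊕ ∅)
    ⊕∅-minDom (dom , minimal) = ⊕∅-dominating dom , λ T T⊆ domT →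
      let T≡ = ⊆⊕∅⇒≡partΓ⊕∅ T⊆ in
      trans T≡ (cong (_⊕ ∅) (minimal (partΓ T) (ι∈⊕⇒∈ ∘ T⊆ ∘ ∈partΓ⇒ι∈)
                                     (⊕∅-dominating⁻ (subst (Dominating J) T≡ domT))))

    ⊕∅-minDom⁻ : ∀ {A} → IsMinDom J (A ⊕ ∅) → IsMinDom Γ A
    ⊕∅-minDom⁻ {A} (dom , minimal) = ⊕∅-dominating⁻ dom , λ T T⊆A domT →
      trans (sym (partΓ-⊕ T ∅))
            (trans (cong partΓ (minimal (T ⊕ ∅) (⊕-mono T⊆A id) (⊕∅-dominating domT))) (partΓ-⊕ A ∅))

    ⊕∅-step : ∀ {A B} → Step Γ A B → Step J (A ⊕ ∅) (B ⊕ ∅)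
    ⊕∅-step (v , entering , adjacent) = ι v , entering' , adjacent'
      where
      entering' : ∀ w → (w ∈ _ ⊕ ∅ × w ∉ _ ⊕ ∅) ⇔ (w ≡ ι v)
      entering' w with ι-or-κ w
      ... | inj₁ (x , refl) =
        mk⇔ (λ (x∈B , x∉A) → cong ι (to (entering x) (ι∈⊕⇒∈ x∈B , x∉A ∘ ∈⇒ι∈⊕)))
            (λ eq → let (x∈B , x∉A) = from (entering x) (ι-injective eq) in ∈⇒ι∈⊕ x∈B , x∉A ∘ ι∈⊕⇒∈)
      ... | inj₂ (y , refl) = mk⇔ (⊥-elim ∘ κ∉⊕∅ ∘ proj₁) (⊥-elim ∘ ι≢κ ∘ sym)
      adjacent' : ∀ w → w ∈ _ ⊕ ∅ → w ∉ _ ⊕ ∅ → Adj J (ι v) w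
      adjacent' w w∈A w∉B with ι-or-κ w
      ... | inj₁ (x , refl) = Adj-ι (adjacent x (ι∈⊕⇒∈ w∈A) (w∉B ∘ ∈⇒ι∈⊕))
      ... | inj₂ (y , refl) = ⊥-elim (κ∉⊕∅ w∈A)

    ⊕∅-step⁻ : ∀ {A B} → Step J (A ⊕ ∅) (B ⊕ ∅) → Step Γ A B
    ⊕∅-step⁻ (z , entering , adjacent) with ι-or-κ z
    ... | inj₂ (y , refl) = ⊥-elim (κ∉⊕∅ (proj₁ (from (entering (κ y)) refl)))
    ... | inj₁ (v , refl) = v , entering' , adjacent'
      where
      entering' : ∀ x → (x ∈ _ × x ∉ _) ⇔ (x ≡ v)
      entering' x =
        mk⇔ (λ (x∈B , x∉A) → ι-injective (to (entering (ι x)) (∈⇒ι∈⊕ x∈B , x∉A ∘ ι∈⊕⇒∈)))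
            (λ eq → let (x∈B , x∉A) = from (entering (ι x)) (cong ι eq) in ι∈⊕⇒∈ x∈B , x∉A ∘ ∈⇒ι∈⊕)
      adjacent' : ∀ x → x ∈ _ → x ∉ _ → Adj Γ v x
      adjacent' x x∈A x∉B = Adj-ι⁻ (adjacent (ι x) (∈⇒ι∈⊕ x∈A) (x∉B ∘ ι∈⊕⇒∈))

    ⊕∅-RAdj : ∀ {A B} → (Step Γ A B ⊎ Step Γ B A) ⇔ (Step J (A ⊕ ∅) (B ⊕ ∅) ⊎ Step J (B ⊕ ∅) (A ⊕ ∅))
    ⊕∅-RAdj = mk⇔ (⊎-map ⊕∅-step ⊕∅-step) (⊎-map ⊕∅-step⁻ ⊕∅-step⁻)

    ¬⊕∅-step-∅⊕ : ∀ {A B} → Dominating Δ B → ¬ Step J (A ⊕ ∅) (∅ ⊕ B)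
    ¬⊕∅-step-∅⊕ {A} {B} dom (z , entering , _) with ι-or-κ z
    ... | inj₁ (x , refl) = ∉⊥ (ι∈⊕⇒∈ (proj₁ (from (entering (ι x)) refl)))
    ... | inj₂ (c , refl) = noUniversalΔ c (dominating⇒universal Δ dom B⊆c)
      where
      B⊆c : ∀ y → y ∈ B → y ≡ c
      B⊆c y y∈B = κ-injective (to (entering (κ y)) (∈⇒κ∈⊕ y∈B , κ∉⊕∅))

    pair : Fin (n Γ) → Fin (n Δ) → Subset N
    pair a b = ⁅ a ⁆ ⊕ ⁅ b ⁆

    ι∈pair : ∀ {a b x} → x ≡ a → ι x ∈ pair a b
    ι∈pair refl = ∈⇒ι∈⊕ (x∈⁅x⁆ _)

    κ∈pair : ∀ {a b y} → y ≡ b → κ y ∈ pair a b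
    κ∈pair refl = ∈⇒κ∈⊕ (x∈⁅x⁆ _)

    ι∈pair⇒≡ : ∀ {a b x} → ι x ∈ pair a b → x ≡ a
    ι∈pair⇒≡ = x∈⁅y⁆⇒x≡y _ ∘ ι∈⊕⇒∈

    κ∈pair⇒≡ : ∀ {a b y} → κ y ∈ pair a b → y ≡ b
    κ∈pair⇒≡ = x∈⁅y⁆⇒x≡y _ ∘ κ∈⊕⇒∈

    pair-dominating : ∀ {a b} → Dominating J (pair a b)
    pair-dominating = ⊕-dominating (x∈⁅x⁆ _) (x∈⁅x⁆ _)

    pair-⊆ : ∀ {T a b} → ι a ∈ T → κ b ∈ T → pair a b ⊆ T
    pair-⊆ {T} ιa∈T κb∈T {i} i∈ with ι-or-κ i
    ... | inj₁ (x , refl) = subst (λ z → ι z ∈ T) (sym (ι∈pair⇒≡ i∈)) ιa∈T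
    ... | inj₂ (y , refl) = subst (λ z → κ z ∈ T) (sym (κ∈pair⇒≡ i∈)) κb∈T

    -- Without ι a, only κ b can dominate the vertices of Δ, which would make b universal in Δ.
    pair-minimal-ι : ∀ {T a b} → T ⊆ pair a b → Dominating J T → ι a ∈ T
    pair-minimal-ι {T} {a} {b} T⊆ dom with ι a ∈? T
    ... | yes ιa∈T = ιa∈T
    ... | no ιa∉T = ⊥-elim (noUniversalΔ b b-universal)
      where
      b-universal : Universal Δ b
      b-universal y y≢b with dom (κ y)
      ... | inj₁ κy∈T = ⊥-elim (y≢b (κ∈pair⇒≡ (T⊆ κy∈T)))
      ... | inj₂ (i , i∈T , i~κy) with ι-or-κ i
      ...   | inj₁ (x , refl) = ⊥-elim (ιa∉T (subst (λ z → ι z ∈ T) (ι∈pair⇒≡ (T⊆ i∈T)) i∈T))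
      ...   | inj₂ (c , refl) = subst (λ z → Adj Δ z y) (κ∈pair⇒≡ (T⊆ i∈T)) (Adj-κ⁻ i~κy)

    -- Leaving M for {a, b} both κ b and (unless a ∈ M) ι a would enter, but a step adds one vertex.
    ⊕∅-step-pair⇒∈ : ∀ {M a b} → Step J (M ⊕ ∅) (pair a b) → a ∈ M
    ⊕∅-step-pair⇒∈ {M} {a} (_ , entering , _) with a ∈? M
    ... | yes a∈M = a∈M
    ... | no a∉M = ⊥-elim (ι≢κ (trans (to (entering (ι a)) (ι∈pair refl , a∉M ∘ ι∈⊕⇒∈))
                                       (sym (to (entering (κ _)) (κ∈pair refl , κ∉⊕∅)))))

    -- If a ∉ M, all of M enters at the single vertex of the step, which is then universal.
    pair-step-⊕∅⇒∈ : ∀ {M a b} → Dominating Γ M → Step J (pair a b) (M ⊕ ∅) → a ∈ M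
    pair-step-⊕∅⇒∈ {M} {a} dom (z , entering , _) with a ∈? M
    ... | yes a∈M = a∈M
    ... | no a∉M with ι-or-κ z
    ...   | inj₂ (y , refl) = ⊥-elim (κ∉⊕∅ (proj₁ (from (entering (κ y)) refl)))
    ...   | inj₁ (c , refl) = ⊥-elim (noUniversalΓ c (dominating⇒universal Γ dom M⊆c))
      where
      M⊆c : ∀ x → x ∈ M → x ≡ c
      M⊆c x x∈M = ι-injective (to (entering (ι x))
                    (∈⇒ι∈⊕ x∈M , λ ιx∈pair → a∉M (subst (_∈ M) (ι∈pair⇒≡ ιx∈pair) x∈M)))

    ∈⇒⊕∅-step-pair : ∀ {M a b} → a ∈ M → Step J (M ⊕ ∅) (pair a b)
    ∈⇒⊕∅-step-pair {M} {a} {b} a∈M = κ b , entering , adjacent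
      where
      entering : ∀ w → (w ∈ pair a b × w ∉ M ⊕ ∅) ⇔ (w ≡ κ b)
      entering w with ι-or-κ w
      ... | inj₁ (x , refl) =
        mk⇔ (λ (x∈ , x∉) → ⊥-elim (x∉ (∈⇒ι∈⊕ (subst (_∈ M) (sym (ι∈pair⇒≡ x∈)) a∈M)))) (⊥-elim ∘ ι≢κ)
      ... | inj₂ (y , refl) = mk⇔ (cong κ ∘ κ∈pair⇒≡ ∘ proj₁) (λ eq → κ∈pair (κ-injective eq) , κ∉⊕∅)
      adjacent : ∀ w → w ∈ M ⊕ ∅ → w ∉ pair a b → Adj J (κ b) w
      adjacent w w∈M _ with ι-or-κ w
      ... | inj₁ (x , refl) = Adj-κι
      ... | inj₂ (y , refl) = ⊥-elim (κ∉⊕∅ w∈M)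

    ∈⇔⊕∅-RAdj-pair : ∀ {M a b} → Dominating Γ M →
                     a ∈ M ⇔ (Step J (M ⊕ ∅) (pair a b) ⊎ Step J (pair a b) (M ⊕ ∅))
    ∈⇔⊕∅-RAdj-pair dom = mk⇔ (inj₁ ∘ ∈⇒⊕∅-step-pair) [ ⊕∅-step-pair⇒∈ , pair-step-⊕∅⇒∈ dom ]

    pair-step : ∀ {a b a' b'} → b ≡ b' → Adj Γ a a' → Step J (pair a b) (pair a' b')
    pair-step {a} {b} {a'} refl a~a' = ι a' , entering , adjacent
      where
      a≢a' : a ≢ a'
      a≢a' eq = Graph.irrefl Γ (subst (Adj Γ a) (sym eq) a~a')
      entering : ∀ w → (w ∈ pair a' b × w ∉ pair a b) ⇔ (w ≡ ι a')
      entering w with ι-or-κ w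
      ... | inj₁ (x , refl) =
        mk⇔ (cong ι ∘ ι∈pair⇒≡ ∘ proj₁)
            (λ eq → ι∈pair (ι-injective eq) , λ x∈ → a≢a' (trans (sym (ι∈pair⇒≡ x∈)) (ι-injective eq)))
      ... | inj₂ (y , refl) =
        mk⇔ (λ (y∈ , y∉) → ⊥-elim (y∉ (κ∈pair (κ∈pair⇒≡ y∈)))) (⊥-elim ∘ ι≢κ ∘ sym)
      adjacent : ∀ w → w ∈ pair a b → w ∉ pair a' b → Adj J (ι a') w
      adjacent w w∈ w∉ with ι-or-κ w
      ... | inj₁ (x , refl) = Adj-ι (subst (Adj Γ a') (sym (ι∈pair⇒≡ w∈)) (Graph.sym Γ a~a'))
      ... | inj₂ (y , refl) = ⊥-elim (w∉ (κ∈pair (κ∈pair⇒≡ w∈)))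

    -- Only ι a' can enter at ι c, so c = a'; and ι a must leave, hence be adjacent to ι c.
    pair-stepVia-ι⇒ : ∀ {a b a' b' c} → StepVia J (pair a b) (pair a' b') (ι c) → b ≡ b' × Adj Γ a a'
    pair-stepVia-ι⇒ {a} {b} {a'} {b'} {c} (entering , adjacent) =
      b≡b' , Graph.sym Γ (subst (λ z → Adj Γ z a) c≡a' c~a)
      where
      c-enters : ι c ∈ pair a' b' × ι c ∉ pair a b
      c-enters = from (entering (ι c)) refl
      c≡a' : c ≡ a'
      c≡a' = ι∈pair⇒≡ (proj₁ c-enters)
      c≢a : c ≢ a
      c≢a eq = proj₂ c-enters (ι∈pair eq)
      b≡b' : b ≡ b'
      b≡b' with b ≟ᶠ b'
      ... | yes eq = eq
      ... | no b≢b' = ⊥-elim (ι≢κ (sym (to (entering (κ b')) (κ∈pair refl , b≢b' ∘ sym ∘ κ∈pair⇒≡))))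
      c~a : Adj Γ c a
      c~a = Adj-ι⁻ (adjacent (ι a) (ι∈pair refl) (λ ιa∈ → c≢a (trans c≡a' (sym (ι∈pair⇒≡ ιa∈)))))

  module GV = JoinViewProperties viewG
  module HV = JoinViewProperties viewH

  pair-minDom : ∀ u v → IsMinDom J (GV.pair u v)
  pair-minDom u v = GV.pair-dominating {u} {v} , λ T T⊆ dom →
    ⊆-antisym T⊆ (GV.pair-⊆ (GV.pair-minimal-ι {a = u} {v} T⊆ dom) (HV.pair-minimal-ι {a = v} {u} T⊆ dom))

  ofX : XVert G H → MinDom J
  ofX (inj₁ (mkMD A p)) = mkMD (A ++ ∅) (GV.⊕∅-minDom p)
  ofX (inj₂ (inj₁ (mkMD B p))) = mkMD (∅ ++ B) (HV.⊕∅-minDom p)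
  ofX (inj₂ (inj₂ (u , v))) = mkMD (GV.pair u v) (pair-minDom u v)

  partG : Subset N → Subset m
  partG = GV.partΓ

  partH : Subset N → Subset k
  partH = GV.partΔ

  classify : (S : Subset N) → .(IsMinDom J S) → Dec (Nonempty (partG S)) → Dec (Nonempty (partH S)) → XVert G H
  classify S _ (yes (u , _)) (yes (v , _)) = inj₂ (inj₂ (u , v))
  classify S S-min (yes _) (no partH-empty) =
    inj₁ (mkMD (partG S) (GV.⊕∅-minDom⁻ (subst (IsMinDom J) (GV.≡partΓ⊕∅ partH-empty) S-min)))
  classify S S-min (no partG-empty) (yes _) =
    inj₂ (inj₁ (mkMD (partH S) (HV.⊕∅-minDom⁻ (subst (IsMinDom J) (HV.≡partΓ⊕∅ partG-empty) S-min))))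
  -- Unreachable (see ¬parts-empty); any value will do.
  classify S _ (no _) (no _) = inj₂ (inj₂ (fromℕ< 1≤nG , fromℕ< 1≤nH))

  toX : MinDom J → XVert G H
  toX (mkMD S p) = classify S p (nonempty? _) (nonempty? _)

  ¬parts-empty : ∀ {S} → Dominating J S → Empty (partG S) → Empty (partH S) → ⊥
  ¬parts-empty dom partG-empty partH-empty with dominating⇒nonempty J (fromℕ< 1≤nG ↑ˡ k) dom
  ... | i , i∈S with ↑ˡ-or-↑ʳ i
  ...   | inj₁ (x , refl) = partG-empty (x , GV.ι∈⇒∈partΓ i∈S)
  ...   | inj₂ (y , refl) = partH-empty (y , GV.κ∈⇒∈partΔ i∈S)

  ofX-classify : ∀ S .(p : IsMinDom J S) dG dH → ofX (classify S p dG dH) ≡ mkMD S p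
  ofX-classify S p (yes (u , u∈)) (yes (v , v∈)) =
    minDom-≡ J (minDom-minimal {J} (mkMD S p) (GV.pair u v) (GV.pair-⊆ (GV.∈partΓ⇒ι∈ u∈) (GV.∈partΔ⇒κ∈ v∈)) (GV.pair-dominating {u} {v}))
  ofX-classify S p (yes _) (no partH-empty) = minDom-≡ J (sym (GV.≡partΓ⊕∅ partH-empty))
  ofX-classify S p (no partG-empty) (yes _) = minDom-≡ J (sym (HV.≡partΓ⊕∅ partG-empty))
  ofX-classify S p (no partG-empty) (no partH-empty) = ⊥-elim-irr (¬parts-empty (proj₁ p) partG-empty partH-empty)

  ofX∘toX : ∀ M → ofX (toX M) ≡ M
  ofX∘toX (mkMD S p) = ofX-classify S p (nonempty? _) (nonempty? _)

  classify-G : ∀ A .(p : IsMinDom G A) dG dH → classify (A ++ ∅) (GV.⊕∅-minDom p) dG dH ≡ inj₁ (mkMD A p)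
  classify-G A p (yes _) (yes (_ , v∈)) = ⊥-elim (GV.κ∉⊕∅ {A = A} (GV.∈partΔ⇒κ∈ v∈))
  classify-G A p (yes _) (no _) = cong inj₁ (minDom-≡ G (GV.partΓ-⊕ A ∅))
  classify-G A p (no partG-empty) _ =
    ⊥-elim-irr (partG-empty (GV.partΓ-nonempty (proj₂ (dominating⇒nonempty G (fromℕ< 1≤nG) (proj₁ p)))))

  classify-H : ∀ B .(p : IsMinDom H B) dG dH → classify (∅ ++ B) (HV.⊕∅-minDom p) dG dH ≡ inj₂ (inj₁ (mkMD B p))
  classify-H B p (yes (_ , u∈)) _ = ⊥-elim (HV.κ∉⊕∅ {A = B} (HV.∈partΔ⇒κ∈ u∈))
  classify-H B p (no _) (yes _) = cong (inj₂ ∘ inj₁) (minDom-≡ H (HV.partΓ-⊕ B ∅))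
  classify-H B p (no _) (no partH-empty) =
    ⊥-elim-irr (partH-empty (HV.partΓ-nonempty {B = ∅} (proj₂ (dominating⇒nonempty H (fromℕ< 1≤nH) (proj₁ p)))))

  classify-pair : ∀ u v dG dH → classify (GV.pair u v) (pair-minDom u v) dG dH ≡ inj₂ (inj₂ (u , v))
  classify-pair u v (yes (_ , u'∈)) (yes (_ , v'∈)) =
    cong (inj₂ ∘ inj₂) (cong₂ _,_ (GV.ι∈pair⇒≡ {b = v} (GV.∈partΓ⇒ι∈ u'∈))
                                   (GV.κ∈pair⇒≡ {a = u} (GV.∈partΔ⇒κ∈ v'∈)))
  classify-pair u v (no partG-empty) _ = ⊥-elim (partG-empty (GV.partΓ-nonempty (x∈⁅x⁆ u)))
  classify-pair u v (yes _) (no partH-empty) = ⊥-elim (partH-empty (GV.partΔ-nonempty {A = ⁅ u ⁆} (x∈⁅x⁆ v)))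

  toX∘ofX : ∀ x → toX (ofX x) ≡ x
  toX∘ofX (inj₁ (mkMD A p)) = classify-G A p _ _
  toX∘ofX (inj₂ (inj₁ (mkMD B p))) = classify-H B p _ _
  toX∘ofX (inj₂ (inj₂ (u , v))) = classify-pair u v _ _

  □-Adj : Fin m × Fin k → Fin m × Fin k → Set
  □-Adj (u , v) (u' , v') = (u ≡ u' × Adj H v v') ⊎ (v ≡ v' × Adj G u u')

  □-Adj-sym : ∀ {x y} → □-Adj x y → □-Adj y x
  □-Adj-sym = ⊎-map (λ (eq , a) → sym eq , Graph.sym H a) (λ (eq , a) → sym eq , Graph.sym G a)

  □-Adj⇒pair-step : ∀ {u v u' v'} → □-Adj (u , v) (u' , v') → Step J (GV.pair u v) (GV.pair u' v')
  □-Adj⇒pair-step (inj₁ (u≡u' , v~v')) = HV.pair-step u≡u' v~v'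
  □-Adj⇒pair-step (inj₂ (v≡v' , u~u')) = GV.pair-step v≡v' u~u'

  pair-step⇒□-Adj : ∀ {u v u' v'} → Step J (GV.pair u v) (GV.pair u' v') → □-Adj (u , v) (u' , v')
  pair-step⇒□-Adj (z , via) with ↑ˡ-or-↑ʳ z
  ... | inj₁ (_ , refl) = inj₂ (GV.pair-stepVia-ι⇒ via)
  ... | inj₂ (_ , refl) = inj₁ (HV.pair-stepVia-ι⇒ via)

  □-Adj⇔pair-RAdj : ∀ {u v u' v'} →
    □-Adj (u , v) (u' , v') ⇔ (Step J (GV.pair u v) (GV.pair u' v') ⊎ Step J (GV.pair u' v') (GV.pair u v))
  □-Adj⇔pair-RAdj = mk⇔ (inj₁ ∘ □-Adj⇒pair-step) [ pair-step⇒□-Adj , □-Adj-sym ∘ pair-step⇒□-Adj ]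

  ¬RAdj-G-H : ∀ {A B} → Dominating G A → Dominating H B →
              ¬ (Step J (A ++ ∅) (∅ ++ B) ⊎ Step J (∅ ++ B) (A ++ ∅))
  ¬RAdj-G-H domA domB = [ GV.¬⊕∅-step-∅⊕ domB , HV.¬⊕∅-step-∅⊕ domA ]

  XAdj⇔RAdj-ofX : ∀ x y → XAdj G H x y ⇔ RAdj J (ofX x) (ofX y)
  XAdj⇔RAdj-ofX (inj₁ _) (inj₁ _) = GV.⊕∅-RAdj
  XAdj⇔RAdj-ofX (inj₂ (inj₁ _)) (inj₂ (inj₁ _)) = HV.⊕∅-RAdj
  XAdj⇔RAdj-ofX (inj₂ (inj₂ _)) (inj₂ (inj₂ _)) = □-Adj⇔pair-RAdj
  XAdj⇔RAdj-ofX (inj₁ A) (inj₂ (inj₂ _)) = GV.∈⇔⊕∅-RAdj-pair (minDom-dominating A)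
  XAdj⇔RAdj-ofX (inj₂ (inj₂ _)) (inj₁ A) = ⇔-⊎-swap (GV.∈⇔⊕∅-RAdj-pair (minDom-dominating A))
  XAdj⇔RAdj-ofX (inj₂ (inj₁ B)) (inj₂ (inj₂ _)) = HV.∈⇔⊕∅-RAdj-pair (minDom-dominating B)
  XAdj⇔RAdj-ofX (inj₂ (inj₂ _)) (inj₂ (inj₁ B)) = ⇔-⊎-swap (HV.∈⇔⊕∅-RAdj-pair (minDom-dominating B))
  XAdj⇔RAdj-ofX (inj₁ A) (inj₂ (inj₁ B)) =
    mk⇔ (λ ()) (⊥-elim ∘ ¬RAdj-G-H (minDom-dominating A) (minDom-dominating B))
  XAdj⇔RAdj-ofX (inj₂ (inj₁ B)) (inj₁ A) =
    mk⇔ (λ ()) (⊥-elim ∘ ¬RAdj-G-H (minDom-dominating A) (minDom-dominating B) ∘ swap)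

  toX-bijection : MinDom J ⤖ XVert G H
  toX-bijection = mk⤖ {to = toX} (toX-injective , λ x → ofX x , λ eq → trans (cong toX eq) (toX∘ofX x))
    where
    toX-injective : ∀ {M M'} → toX M ≡ toX M' → M ≡ M'
    toX-injective {M} {M'} eq = trans (sym (ofX∘toX M)) (trans (cong ofX eq) (ofX∘toX M'))

  RAdj⇔XAdj-toX : ∀ M M' → RAdj J M M' ⇔ XAdj G H (toX M) (toX M')
  RAdj⇔XAdj-toX M M' =
    mk⇔ (λ r → from (XAdj⇔RAdj-ofX (toX M) (toX M')) (subst₂ (RAdj J) (sym (ofX∘toX M)) (sym (ofX∘toX M')) r))
        (λ a → subst₂ (RAdj J) (ofX∘toX M) (ofX∘toX M') (to (XAdj⇔RAdj-ofX (toX M) (toX M')) a))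

theorem4 : (G H : Graph) → 1 ≤ n G → 1 ≤ n H →
    NoUniversal G → NoUniversal H →
    Isomorphic (MinDom (G ∨ᴳ H)) (XVert G H) (RAdj (G ∨ᴳ H)) (XAdj G H)
theorem4 G H 1≤nG 1≤nH noUniversalG noUniversalH = toX-bijection , RAdj⇔XAdj-toX
  where open JoinReconfiguration G H 1≤nG 1≤nH noUniversalG noUniversalH
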